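{- Let $k\in\mathbb{N}$, let $\alpha_1,\ldots,\alpha_{2k}$ be natural numbers, and let $G=C(\alpha_1,\ldots,\alpha_{2k})$. Then $-1$ is an eigenvalue of the quotient matrix $Q_\pi(G)$ if and only if $\alpha_2=1$. Moreover, if $\alpha_2=1$, then $-1$ is a simple eigenvalue of $Q_\pi(G)$.
   Context: For natural numbers $\alpha_1,\ldots,\alpha_m$, the graph $C(\alpha_1,\ldots,\alpha_m)$ is defined recursively: $C(\alpha_1)=\overline{K_{\alpha_1}}$ (edgeless graph on $\alpha_1$ vertices), and $C(\alpha_1,\ldots,\alpha_i)=\overline{C(\alpha_1,\ldots,\alpha_{i-1})\cup K_{\alpha_i}}$ for $i\ge 2$ (disjoint union with the complete graph $K_{\alpha_i}$, followed by complementation). For $G=C(\alpha_1,\ldots,\alpha_{2k})$, let $C_i$ ($1\le i\le 2k$) be the set of $\alpha_i$ vertices added at the $i$-th step; $\pi=\{C_1,\ldots,C_{2k}\}$ is an equitable partition. Its quotient matrix $Q_\pi(G)=[q_{ij}]_{1\le i,j\le 2k}$ (with $q_{ij}$ the number of neighbours in $C_j$ of any vertex of $C_i$) is: for $i$ odd, $q_{ii}=\alpha_i-1$, $q_{ij}=0$ for $j<i$, and for $j>i$, $q_{ij}=\alpha_j$ if $j$ is even and $0$ if $j$ is odd; for $i$ even, $q_{ii}=0$, $q_{ij}=\alpha_j$ for $j<i$, and for $j>i$, $q_{ij}=\alpha_j$ if $j$ is even and $0$ if $j$ is odd. -}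

module Defs where

open import Data.Nat as ℕ using (ℕ; zero; suc; _≤_; _<_; s≤s; z≤n)
open import Data.Nat.Properties using (*-monoʳ-≤)
open import Data.Integer as ℤ using (ℤ; +_; -_; 0ℤ; 1ℤ)
open import Data.Fin using (Fin; toℕ; punchIn; fromℕ<)
import Data.Fin as F
open import Data.List using (List; []; _∷_)
open import Data.Bool using (Bool; true; false; if_then_else_)
open import Data.Product using (Σ; ∃; _×_)
open import Relation.Binary.PropositionalEquality using (_≡_)
open import Relation.Nullary using (¬_; does)

-- Polynomials over ℤ as coefficient lists (lowest degree first).

Poly : Set
Poly = List ℤ

coeff : Poly → ℕ → ℤ
coeff []       _       = 0ℤ
coeff (a ∷ p)  zero    = a
coeff (a ∷ p)  (suc i) = coeff p i

-- equality of polynomials: all coefficients agree (trailing zeros irrelevant)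
_≈ₚ_ : Poly → Poly → Set
p ≈ₚ q = ∀ i → coeff p i ≡ coeff q i

infix 4 _≈ₚ_

_+ₚ_ : Poly → Poly → Poly
[]      +ₚ q       = q
(a ∷ p) +ₚ []      = a ∷ p
(a ∷ p) +ₚ (b ∷ q) = (a ℤ.+ b) ∷ (p +ₚ q)

scaleₚ : ℤ → Poly → Poly
scaleₚ c []      = []
scaleₚ c (a ∷ p) = (c ℤ.* a) ∷ scaleₚ c p

_*ₚ_ : Poly → Poly → Poly
[]      *ₚ q = []
(a ∷ p) *ₚ q = scaleₚ a q +ₚ (0ℤ ∷ (p *ₚ q))

constₚ : ℤ → Poly
constₚ c = c ∷ []

Xₚ : Poly
Xₚ = 0ℤ ∷ 1ℤ ∷ []

_^ₚ_ : Poly → ℕ → Poly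
p ^ₚ zero  = constₚ 1ℤ
p ^ₚ suc n = p *ₚ (p ^ₚ n)

evalₚ : Poly → ℤ → ℤ
evalₚ []      x = 0ℤ
evalₚ (a ∷ p) x = a ℤ.+ x ℤ.* evalₚ p x

Matrix : Set → ℕ → Set
Matrix A n = Fin n → Fin n → A

sumFin : ∀ {n} → (Fin n → Poly) → Poly
sumFin {zero}  f = []
sumFin {suc n} f = f F.zero +ₚ sumFin (λ j → f (F.suc j))

sign : ℕ → ℤ
sign zero          = 1ℤ
sign (suc zero)    = - 1ℤ
sign (suc (suc n)) = sign n

minor : ∀ {n} → Matrix Poly (suc n) → Fin (suc n) → Matrix Poly n
minor M j r c = M (F.suc r) (punchIn j c)

det : ∀ n → Matrix Poly n → Poly
det zero    M = constₚ 1ℤ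
det (suc n) M =
  sumFin (λ j → scaleₚ (sign (toℕ j)) (M F.zero j *ₚ det n (minor M j)))

charPoly : ∀ n → Matrix ℤ n → Poly
charPoly n A = det n (λ i j →
  (if does (i F.≟ j) then Xₚ else []) +ₚ constₚ (- A i j))

IsEigenvalue : ∀ n → Matrix ℤ n → ℤ → Set
IsEigenvalue n A λ₀ = evalₚ (charPoly n A) λ₀ ≡ 0ℤ

MultAtLeast : ∀ n → Matrix ℤ n → ℤ → ℕ → Set
MultAtLeast n A λ₀ m =
  Σ Poly (λ q → charPoly n A ≈ₚ ((Xₚ +ₚ constₚ (- λ₀)) ^ₚ m) *ₚ q)

IsSimpleEigenvalue : ∀ n → Matrix ℤ n → ℤ → Set
IsSimpleEigenvalue n A λ₀ = IsEigenvalue n A λ₀ × ¬ MultAtLeast n A λ₀ 2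

-- The quotient matrix Q_π(C(α₁,…,α_{2k})).
-- Index i : Fin (2k) stands for the 1-based index toℕ i + 1, so the
-- paper's index is odd iff toℕ i is even.

evenℕ : ℕ → Bool
evenℕ zero          = true
evenℕ (suc zero)    = false
evenℕ (suc (suc n)) = evenℕ n

oddIdx : ∀ {n} → Fin n → Bool
oddIdx i = evenℕ (toℕ i)

quotientMatrix : ∀ k → (Fin (2 ℕ.* k) → ℕ) → Matrix ℤ (2 ℕ.* k)
quotientMatrix k α i j with toℕ i ℕ.<ᵇ toℕ j | toℕ j ℕ.<ᵇ toℕ i
... | true  | _     = if oddIdx j then 0ℤ else + α j
... | false | true  = if oddIdx i then 0ℤ else + α j
... | false | false = if oddIdx i then (+ α i) ℤ.- 1ℤ else 0ℤ

-- the position of α₂ (paper index 2) in Fin (2k), for k ≥ 1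
idx2 : ∀ k → 1 ≤ k → Fin (2 ℕ.* k)
idx2 k hk = fromℕ< (*-monoʳ-≤ 2 hk)

-- Write χₙ(x) = det (x I − Q) for the quotient matrix of C(α₁,…,αₙ). In x I − Q the first two
-- rows agree beyond the second column, so subtracting the second row from the first and expanding
-- gives a recurrence expressing χₙ₊₂ through χ and an auxiliary bordered determinant E of the
-- tail (α₃,…,αₙ₊₂). At x = −1 it reads χₙ₊₂(−1) = (α₂ − 1) α₁ (E(−1) − χ(−1)), and by induction
-- over even lengths E(−1) and χ(−1) lie weakly on opposite sides of 0 without both vanishing, so
-- the last factor is nonzero. If α₂ = 1 then χₙ₊₂(x) = (x + 1) h(x) with
-- h(−1) = (1 + α₁)(E(−1) − χ(−1)) ≠ 0. A double root would force m + 1 ∣ h(m) for every m ≥ 0,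
-- while h(m) ≡ h(−1) modulo m + 1 since h is an integer polynomial function; m = |h(−1)| then
-- gives h(−1) = 0.

module Submission where

open import Data.Bool using (Bool; true; false; if_then_else_)
open import Data.Empty using (⊥-elim)
open import Data.Fin as F using (Fin; zero; suc; toℕ; punchIn; punchOut)
import Data.Fin.Properties as FP
import Data.Integer as ℤ
open import Data.Integer using (ℤ; +_; -[1+_]; 0ℤ; 1ℤ; -1ℤ; -_; _+_; _*_; _-_)
open import Data.Integer.Divisibility.Signed
  using (_∣_; divides; ∣-refl; ∣m∣n⇒∣m+n; ∣n⇒∣m*n; ∣m∣n⇒∣m-n; ∣⇒∣ᵤ)
import Data.Integer.Properties as ℤP
open import Algebra.Properties.Semiring.Sum ℤP.+-*-semiring
  using (sum; sum-cong-≗; ∑-comm; ∑-distrib-+; sum-remove; *-distribˡ-sum)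
open import Data.Integer.Tactic.RingSolver using (solve-∀)
open import Data.List using ([]; _∷_)
import Data.Nat as ℕ
open import Data.Nat using (ℕ; zero; suc; _≤_)
open import Data.Nat.Divisibility using (>⇒∤) renaming (_∣_ to _∣ℕ_)
import Data.Nat.Properties as ℕP
open import Data.Product using (Σ; _×_; _,_)
open import Data.Sum using (inj₁; inj₂; [_,_]′)
open import Function using (_∘_)
open import Function.Bundles using (_⇔_; mk⇔; Equivalence)
open import Relation.Binary.PropositionalEquality
open import Relation.Nullary using (¬_; yes; no; does)

open import Defs

sum-zero : ∀ {n} (f : Fin n → ℤ) → (∀ j → f j ≡ 0ℤ) → sum f ≡ 0ℤ
sum-zero {zero}  f f≡0 = refl
sum-zero {suc n} f f≡0 = cong₂ _+_ (f≡0 zero) (sum-zero (f ∘ suc) (f≡0 ∘ suc))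

sum-neg : ∀ {n} (f : Fin n → ℤ) → sum (λ j → - f j) ≡ - sum f
sum-neg {zero}  f = refl
sum-neg {suc n} f = begin
  - f zero + sum (λ j → - f (suc j)) ≡⟨ cong (_+_ (- f zero)) (sum-neg (f ∘ suc)) ⟩
  - f zero + - sum (f ∘ suc)         ≡⟨ ℤP.neg-distrib-+ (f zero) (sum (f ∘ suc)) ⟨
  - (f zero + sum (f ∘ suc))         ∎
  where open ≡-Reasoning

self-negative≡0 : ∀ (x : ℤ) → x ≡ - x → x ≡ 0ℤ
self-negative≡0 (+ zero)  _  = refl
self-negative≡0 (+ suc n) ()
self-negative≡0 -[1+ n ]  ()

sum-antisymmetric≡0 : ∀ {n} (G : Fin n → Fin n → ℤ) → (∀ i j → G i j ≡ - G j i) →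
  sum (λ i → sum (G i)) ≡ 0ℤ
sum-antisymmetric≡0 G G-antisym = self-negative≡0 _ (begin
  sum (λ i → sum (G i))              ≡⟨ ∑-comm G ⟩
  sum (λ j → sum (λ i → G i j))      ≡⟨ sum-cong-≗ (λ j → sum-cong-≗ (λ i → G-antisym i j)) ⟩
  sum (λ j → sum (λ i → - G j i))    ≡⟨ sum-cong-≗ (λ j → sum-neg (G j)) ⟩
  sum (λ j → - sum (G j))            ≡⟨ sum-neg (λ j → sum (G j)) ⟩
  - sum (λ j → sum (G j))            ∎)
  where open ≡-Reasoning

-- Integer determinants, by Laplace expansion along the first row as in Defs.det

minorℤ : ∀ {n} → Matrix ℤ (suc n) → Fin (suc n) → Matrix ℤ n
minorℤ M j r c = M (suc r) (punchIn j c)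

mutual
  detℤ : ∀ n → Matrix ℤ n → ℤ
  detℤ zero    M = 1ℤ
  detℤ (suc n) M = sum (laplaceTerm M)

  laplaceTerm : ∀ {n} → Matrix ℤ (suc n) → Fin (suc n) → ℤ
  laplaceTerm {n} M j = sign (toℕ j) * (M zero j * detℤ n (minorℤ M j))

det-cong : ∀ n {M N : Matrix ℤ n} → (∀ i j → M i j ≡ N i j) → detℤ n M ≡ detℤ n N
det-cong zero    M≡N = refl
det-cong (suc n) M≡N = sum-cong-≗ λ j →
  cong₂ (λ a d → sign (toℕ j) * (a * d)) (M≡N zero j)
        (det-cong n (λ r c → M≡N (suc r) (punchIn j c)))

det-additive-firstRow : ∀ n (M N P : Matrix ℤ (suc n)) →
  (∀ j → M zero j ≡ N zero j + P zero j) →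
  (∀ r j → M (suc r) j ≡ N (suc r) j) → (∀ r j → M (suc r) j ≡ P (suc r) j) →
  detℤ (suc n) M ≡ detℤ (suc n) N + detℤ (suc n) P
det-additive-firstRow n M N P M₀≡N₀+P₀ M≡N M≡P =
  trans (sum-cong-≗ term) (∑-distrib-+ (laplaceTerm N) (laplaceTerm P))
  where
  open ≡-Reasoning
  distrib : ∀ s a b d → s * ((a + b) * d) ≡ s * (a * d) + s * (b * d)
  distrib = solve-∀
  term : ∀ j → laplaceTerm M j ≡ laplaceTerm N j + laplaceTerm P j
  term j = begin
    s * (M zero j * detℤ n (minorℤ M j))
      ≡⟨ cong (λ a → s * (a * detℤ n (minorℤ M j))) (M₀≡N₀+P₀ j) ⟩
    s * ((N zero j + P zero j) * detℤ n (minorℤ M j))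
      ≡⟨ distrib s (N zero j) (P zero j) (detℤ n (minorℤ M j)) ⟩
    s * (N zero j * detℤ n (minorℤ M j)) + s * (P zero j * detℤ n (minorℤ M j))
      ≡⟨ cong₂ (λ d e → s * (N zero j * d) + s * (P zero j * e))
               (det-cong n (λ r c → M≡N r (punchIn j c))) (det-cong n (λ r c → M≡P r (punchIn j c))) ⟩
    laplaceTerm N j + laplaceTerm P j ∎
    where
    s : ℤ
    s = sign (toℕ j)

record IsFirstColumnCombination {n} (a b : ℤ) (M N P : Matrix ℤ (suc n)) : Set where
  constructor firstColumnCombination
  field
    firstColumn : ∀ r → M r zero ≡ a * N r zero + b * P r zero
    restN       : ∀ r c → M r (suc c) ≡ N r (suc c)
    restP       : ∀ r c → M r (suc c) ≡ P r (suc c)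

minor-firstColumnCombination : ∀ {n a b} {M N P : Matrix ℤ (suc (suc n))} j →
  IsFirstColumnCombination a b M N P →
  IsFirstColumnCombination a b (minorℤ M (suc j)) (minorℤ N (suc j)) (minorℤ P (suc j))
minor-firstColumnCombination j (firstColumnCombination M₀ M≡N M≡P) =
  firstColumnCombination (M₀ ∘ suc) (λ r c → M≡N (suc r) (punchIn j c)) (λ r c → M≡P (suc r) (punchIn j c))

mutual
  det-linear-firstColumn : ∀ n {a b} {M N P : Matrix ℤ (suc n)} →
    IsFirstColumnCombination a b M N P →
    detℤ (suc n) M ≡ a * detℤ (suc n) N + b * detℤ (suc n) P
  det-linear-firstColumn n {a} {b} {M} {N} {P} comb = begin
    sum (laplaceTerm M)
      ≡⟨ sum-cong-≗ (laplaceTerm-linear-firstColumn n comb) ⟩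
    sum (λ j → a * laplaceTerm N j + b * laplaceTerm P j)
      ≡⟨ ∑-distrib-+ (λ j → a * laplaceTerm N j) (λ j → b * laplaceTerm P j) ⟩
    sum (λ j → a * laplaceTerm N j) + sum (λ j → b * laplaceTerm P j)
      ≡⟨ cong₂ _+_ (*-distribˡ-sum a (laplaceTerm N)) (*-distribˡ-sum b (laplaceTerm P)) ⟨
    a * sum (laplaceTerm N) + b * sum (laplaceTerm P) ∎
    where open ≡-Reasoning

  laplaceTerm-linear-firstColumn : ∀ n {a b} {M N P : Matrix ℤ (suc n)} →
    IsFirstColumnCombination a b M N P →
    ∀ j → laplaceTerm M j ≡ a * laplaceTerm N j + b * laplaceTerm P j
  laplaceTerm-linear-firstColumn n {a} {b} {M} {N} {P} comb@(firstColumnCombination M₀ M≡N M≡P) zero = begin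
    1ℤ * (M zero zero * detℤ n (minorℤ M zero))
      ≡⟨ cong₂ (λ m d → 1ℤ * (m * d)) (M₀ zero) (det-cong n (λ r c → M≡N (suc r) c)) ⟩
    1ℤ * ((a * N zero zero + b * P zero zero) * detℤ n (minorℤ N zero))
      ≡⟨ expand a b (N zero zero) (P zero zero) (detℤ n (minorℤ N zero)) ⟩
    a * (1ℤ * (N zero zero * detℤ n (minorℤ N zero)))
      + b * (1ℤ * (P zero zero * detℤ n (minorℤ N zero)))
      ≡⟨ cong (λ d → a * laplaceTerm N zero + b * (1ℤ * (P zero zero * d))) minorsNP ⟩
    a * laplaceTerm N zero + b * laplaceTerm P zero ∎
    where
    open ≡-Reasoning
    expand : ∀ a b x y d → 1ℤ * ((a * x + b * y) * d) ≡ a * (1ℤ * (x * d)) + b * (1ℤ * (y * d))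
    expand = solve-∀
    minorsNP : detℤ n (minorℤ N zero) ≡ detℤ n (minorℤ P zero)
    minorsNP = trans (sym (det-cong n (λ r c → M≡N (suc r) c))) (det-cong n (λ r c → M≡P (suc r) c))
  laplaceTerm-linear-firstColumn (suc n) {a} {b} {M} {N} {P} comb@(firstColumnCombination M₀ M≡N M≡P) (suc j) = begin
    s * (M zero (suc j) * detℤ (suc n) (minorℤ M (suc j)))
      ≡⟨ cong₂ (λ m d → s * (m * d)) (M≡N zero j)
               (det-linear-firstColumn n (minor-firstColumnCombination j comb)) ⟩
    s * (N zero (suc j) * (a * dN + b * dP))
      ≡⟨ expand s a b (N zero (suc j)) dN dP ⟩
    a * (s * (N zero (suc j) * dN)) + b * (s * (N zero (suc j) * dP))
      ≡⟨ cong (λ m → a * laplaceTerm N (suc j) + b * (s * (m * dP))) (trans (sym (M≡N zero j)) (M≡P zero j)) ⟩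
    a * laplaceTerm N (suc j) + b * laplaceTerm P (suc j) ∎
    where
    open ≡-Reasoning
    s dN dP : ℤ
    s = sign (toℕ (suc j))
    dN = detℤ (suc n) (minorℤ N (suc j))
    dP = detℤ (suc n) (minorℤ P (suc j))
    expand : ∀ s a b m x y → s * (m * (a * x + b * y)) ≡ a * (s * (m * x)) + b * (s * (m * y))
    expand = solve-∀

det-firstColumn≡0 : ∀ n (M : Matrix ℤ (suc n)) → (∀ r → M r zero ≡ 0ℤ) → detℤ (suc n) M ≡ 0ℤ
det-firstColumn≡0 n M M₀≡0 =
  det-linear-firstColumn n {0ℤ} {0ℤ} {M} {M} {M} (firstColumnCombination M₀≡0 (λ _ _ → refl) (λ _ _ → refl))

det-firstColumnZeroBelow : ∀ n (M : Matrix ℤ (suc n)) → (∀ r → M (suc r) zero ≡ 0ℤ) →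
  detℤ (suc n) M ≡ M zero zero * detℤ n (minorℤ M zero)
det-firstColumnZeroBelow n M below≡0 = begin
  1ℤ * (M zero zero * detℤ n (minorℤ M zero)) + sum (laplaceTerm M ∘ suc)
    ≡⟨ cong₂ _+_ (ℤP.*-identityˡ (M zero zero * detℤ n (minorℤ M zero)))
                 (sum-zero (laplaceTerm M ∘ suc) (laterTerm≡0 n M below≡0)) ⟩
  M zero zero * detℤ n (minorℤ M zero) + 0ℤ
    ≡⟨ ℤP.+-identityʳ (M zero zero * detℤ n (minorℤ M zero)) ⟩
  M zero zero * detℤ n (minorℤ M zero) ∎
  where
  open ≡-Reasoning
  laterTerm≡0 : ∀ n (M : Matrix ℤ (suc n)) → (∀ r → M (suc r) zero ≡ 0ℤ) → ∀ j → laplaceTerm M (suc j) ≡ 0ℤ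
  laterTerm≡0 (suc n) M below≡0 j =
    trans (cong (λ d → sign (toℕ (suc j)) * (M zero (suc j) * d)) (det-firstColumn≡0 n (minorℤ M (suc j)) below≡0))
          (vanish (sign (toℕ (suc j))) (M zero (suc j)))
    where
    vanish : ∀ s m → s * (m * 0ℤ) ≡ 0ℤ
    vanish = solve-∀

sign-suc : ∀ m → sign (suc m) ≡ - sign m
sign-suc zero          = refl
sign-suc (suc zero)    = refl
sign-suc (suc (suc m)) = sign-suc m

punchIn-punchOut-comm : ∀ {n} {i j : Fin (suc (suc n))} (i≢j : i ≢ j) (j≢i : j ≢ i) c →
  punchIn i (punchIn (punchOut i≢j) c) ≡ punchIn j (punchIn (punchOut j≢i) c)
punchIn-punchOut-comm {i = zero}  {zero}  i≢j j≢i c = ⊥-elim (i≢j refl)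
punchIn-punchOut-comm {i = zero}  {suc j} i≢j j≢i c = refl
punchIn-punchOut-comm {i = suc i} {zero}  i≢j j≢i c = refl
punchIn-punchOut-comm {suc n} {suc i} {suc j} i≢j j≢i zero    = refl
punchIn-punchOut-comm {suc n} {suc i} {suc j} i≢j j≢i (suc c) =
  cong suc (punchIn-punchOut-comm (i≢j ∘ cong suc) (j≢i ∘ cong suc) c)

sign-punchOut : ∀ {n} {i j : Fin (suc (suc n))} (i≢j : i ≢ j) (j≢i : j ≢ i) →
  sign (toℕ i) * sign (toℕ (punchOut i≢j)) ≡ - (sign (toℕ j) * sign (toℕ (punchOut j≢i)))
sign-punchOut {i = zero}  {zero}  i≢j j≢i = ⊥-elim (i≢j refl)
sign-punchOut {i = zero}  {suc j} i≢j j≢i rewrite sign-suc (toℕ j) = flip (sign (toℕ j))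
  where
  flip : ∀ s → 1ℤ * s ≡ - (- s * 1ℤ)
  flip = solve-∀
sign-punchOut {i = suc i} {zero}  i≢j j≢i rewrite sign-suc (toℕ i) = flip (sign (toℕ i))
  where
  flip : ∀ s → - s * 1ℤ ≡ - (1ℤ * s)
  flip = solve-∀
sign-punchOut {zero}  {suc zero} {suc zero} i≢j j≢i = ⊥-elim (i≢j refl)
sign-punchOut {suc n} {suc i}    {suc j}    i≢j j≢i
  rewrite sign-suc (toℕ i) | sign-suc (toℕ j)
        | sign-suc (toℕ (punchOut (i≢j ∘ cong suc))) | sign-suc (toℕ (punchOut (j≢i ∘ cong suc)))
  = negate-both (sign (toℕ i)) (sign (toℕ (punchOut (i≢j ∘ cong suc))))
                (sign (toℕ j)) (sign (toℕ (punchOut (j≢i ∘ cong suc))))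
                (sign-punchOut (i≢j ∘ cong suc) (j≢i ∘ cong suc))
  where
  negate-both : ∀ a b c d → a * b ≡ - (c * d) → - a * - b ≡ - (- c * - d)
  negate-both a b c d ab≡-cd = trans (cancel a b) (trans ab≡-cd (cong -_ (sym (cancel c d))))
    where
    cancel : ∀ a b → - a * - b ≡ a * b
    cancel = solve-∀

det-equalFirstRows≡0 : ∀ n (M : Matrix ℤ (suc (suc n))) → (∀ j → M zero j ≡ M (suc zero) j) →
  detℤ (suc (suc n)) M ≡ 0ℤ
det-equalFirstRows≡0 n M rows≡ = trans (sum-cong-≗ expandSecondRow) (sum-antisymmetric≡0 G G-antisym)
  where
  open ≡-Reasoning
  s : ∀ {m} → Fin m → ℤ
  s j = sign (toℕ j)
  doubleMinor : ∀ {j c : Fin (suc (suc n))} → j ≢ c → ℤ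
  doubleMinor {j} j≢c = detℤ n (λ r c′ → M (suc (suc r)) (punchIn j (punchIn (punchOut j≢c) c′)))
  -- The term of the expansion along rows 0 and 1 using columns j and c; it is antisymmetric
  -- because the two rows agree.
  G : Fin (suc (suc n)) → Fin (suc (suc n)) → ℤ
  G j c with j F.≟ c
  ... | yes _   = 0ℤ
  ... | no j≢c = s j * (M zero j * (s (punchOut j≢c) * (M (suc zero) c * doubleMinor j≢c)))

  G-antisym : ∀ i j → G i j ≡ - G j i
  G-antisym i j with i F.≟ j | j F.≟ i
  ... | yes _   | yes _   = refl
  ... | yes i≡j | no j≢i = ⊥-elim (j≢i (sym i≡j))
  ... | no i≢j | yes j≡i = ⊥-elim (i≢j (sym j≡i))
  ... | no i≢j | no j≢i
    rewrite rows≡ i | rows≡ j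
          | det-cong n (λ r c′ → cong (M (suc (suc r))) (punchIn-punchOut-comm i≢j j≢i c′))
    = swap (s i) (s (punchOut i≢j)) (s j) (s (punchOut j≢i)) (M (suc zero) i) (M (suc zero) j)
           (doubleMinor j≢i) (sign-punchOut i≢j j≢i)
    where
    swap : ∀ a b c d x y D → a * b ≡ - (c * d) → a * (x * (b * (y * D))) ≡ - (c * (y * (d * (x * D))))
    swap a b c d x y D ab≡-cd =
      trans (regroup a b x y D) (trans (cong (_* (x * (y * D))) ab≡-cd) (regroup′ c d x y D))
      where
      regroup : ∀ a b x y D → a * (x * (b * (y * D))) ≡ (a * b) * (x * (y * D))
      regroup = solve-∀
      regroup′ : ∀ c d x y D → - (c * d) * (x * (y * D)) ≡ - (c * (y * (d * (x * D))))
      regroup′ = solve-∀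

  G-diagonal : ∀ j → G j j ≡ 0ℤ
  G-diagonal j with j F.≟ j
  ... | yes _   = refl
  ... | no j≢j = ⊥-elim (j≢j refl)

  G-punchIn : ∀ j l → G j (punchIn j l) ≡ s j * (M zero j * laplaceTerm (minorℤ M j) l)
  G-punchIn j l with j F.≟ punchIn j l
  ... | yes j≡ = ⊥-elim (FP.punchInᵢ≢i j l (sym j≡))
  ... | no j≢ = cong (λ p → s j * (M zero j * (s p * (M (suc zero) (punchIn j l) *
                          detℤ n (λ r c′ → M (suc (suc r)) (punchIn j (punchIn p c′)))))))
                     (trans (FP.punchOut-cong j refl) (FP.punchOut-punchIn j))

  expandSecondRow : ∀ j → laplaceTerm M j ≡ sum (G j)
  expandSecondRow j = begin
    s j * (M zero j * sum (laplaceTerm (minorℤ M j)))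
      ≡⟨ cong (s j *_) (*-distribˡ-sum (M zero j) (laplaceTerm (minorℤ M j))) ⟩
    s j * sum (λ l → M zero j * laplaceTerm (minorℤ M j) l)
      ≡⟨ *-distribˡ-sum (s j) (λ l → M zero j * laplaceTerm (minorℤ M j) l) ⟩
    sum (λ l → s j * (M zero j * laplaceTerm (minorℤ M j) l))
      ≡⟨ sum-cong-≗ (G-punchIn j) ⟨
    sum (G j ∘ punchIn j)
      ≡⟨ ℤP.+-identityˡ (sum (G j ∘ punchIn j)) ⟨
    0ℤ + sum (G j ∘ punchIn j)
      ≡⟨ cong (_+ sum (G j ∘ punchIn j)) (G-diagonal j) ⟨
    G j j + sum (G j ∘ punchIn j)
      ≡⟨ sum-remove {i = j} (G j) ⟨
    sum (G j) ∎

det-expandAlongRowDifference : ∀ n (M : Matrix ℤ (suc (suc n))) →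
  (∀ j → M zero (suc (suc j)) ≡ M (suc zero) (suc (suc j))) →
  detℤ (suc (suc n)) M
    ≡ (M zero zero - M (suc zero) zero) * detℤ (suc n) (minorℤ M zero)
      - (M zero (suc zero) - M (suc zero) (suc zero)) * detℤ (suc n) (minorℤ M (suc zero))
det-expandAlongRowDifference n M rowsAgree = begin
  detℤ (suc (suc n)) M
    ≡⟨ det-additive-firstRow (suc n) M difference copy (λ j → split (M zero j) (M (suc zero) j))
                             (λ _ _ → refl) (λ _ _ → refl) ⟩
  detℤ (suc (suc n)) difference + detℤ (suc (suc n)) copy
    ≡⟨ cong (_+_ (detℤ (suc (suc n)) difference)) (det-equalFirstRows≡0 n copy (λ _ → refl)) ⟩
  detℤ (suc (suc n)) difference + 0ℤ
    ≡⟨ ℤP.+-identityʳ (detℤ (suc (suc n)) difference) ⟩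
  t₀ + (t₁ + sum laterTerm)
    ≡⟨ cong (λ rest → t₀ + (t₁ + rest)) (sum-zero laterTerm laterTerm≡0) ⟩
  t₀ + (t₁ + 0ℤ)
    ≡⟨ collect (M zero zero - M (suc zero) zero) (detℤ (suc n) (minorℤ M zero))
               (M zero (suc zero) - M (suc zero) (suc zero)) (detℤ (suc n) (minorℤ M (suc zero))) ⟩
  _ ∎
  where
  open ≡-Reasoning
  difference copy : Matrix ℤ (suc (suc n))
  difference zero    j = M zero j - M (suc zero) j
  difference (suc r) j = M (suc r) j
  copy zero    j = M (suc zero) j
  copy (suc r) j = M (suc r) j
  t₀ t₁ : ℤ
  t₀ = laplaceTerm difference zero
  t₁ = laplaceTerm difference (suc zero)
  split : ∀ a b → a ≡ (a - b) + b
  split = solve-∀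
  collect : ∀ a d b e → 1ℤ * (a * d) + (-1ℤ * (b * e) + 0ℤ) ≡ a * d - b * e
  collect = solve-∀
  laterTerm : Fin n → ℤ
  laterTerm j = laplaceTerm difference (suc (suc j))
  laterTerm≡0 : ∀ j → laterTerm j ≡ 0ℤ
  laterTerm≡0 j = begin
    s * ((M zero (suc (suc j)) - M (suc zero) (suc (suc j))) * d)
      ≡⟨ cong (λ m → s * ((m - M (suc zero) (suc (suc j))) * d)) (rowsAgree j) ⟩
    s * ((M (suc zero) (suc (suc j)) - M (suc zero) (suc (suc j))) * d)
      ≡⟨ cong (λ m → s * (m * d)) (ℤP.+-inverseʳ (M (suc zero) (suc (suc j)))) ⟩
    s * (0ℤ * d)
      ≡⟨ ℤP.*-zeroʳ s ⟩
    0ℤ ∎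
    where
    s d : ℤ
    s = sign (toℕ (suc (suc j)))
    d = detℤ (suc n) (minorℤ difference (suc (suc j)))

-- Polynomial evaluation

evalₚ-+ : ∀ p q x → evalₚ (p +ₚ q) x ≡ evalₚ p x + evalₚ q x
evalₚ-+ []      q       x = sym (ℤP.+-identityˡ (evalₚ q x))
evalₚ-+ (a ∷ p) []      x = sym (ℤP.+-identityʳ (evalₚ (a ∷ p) x))
evalₚ-+ (a ∷ p) (b ∷ q) x =
  trans (cong (λ v → a + b + x * v) (evalₚ-+ p q x)) (shuffle a b x (evalₚ p x) (evalₚ q x))
  where
  shuffle : ∀ a b x u v → (a + b) + x * (u + v) ≡ (a + x * u) + (b + x * v)
  shuffle = solve-∀

evalₚ-scale : ∀ c p x → evalₚ (scaleₚ c p) x ≡ c * evalₚ p x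
evalₚ-scale c []      x = sym (ℤP.*-zeroʳ c)
evalₚ-scale c (a ∷ p) x =
  trans (cong (λ v → c * a + x * v) (evalₚ-scale c p x)) (factor c a x (evalₚ p x))
  where
  factor : ∀ c a x u → c * a + x * (c * u) ≡ c * (a + x * u)
  factor = solve-∀

evalₚ-* : ∀ p q x → evalₚ (p *ₚ q) x ≡ evalₚ p x * evalₚ q x
evalₚ-* []      q x = refl
evalₚ-* (a ∷ p) q x = begin
  evalₚ (scaleₚ a q +ₚ (0ℤ ∷ (p *ₚ q))) x
    ≡⟨ evalₚ-+ (scaleₚ a q) (0ℤ ∷ (p *ₚ q)) x ⟩
  evalₚ (scaleₚ a q) x + (0ℤ + x * evalₚ (p *ₚ q) x)
    ≡⟨ cong₂ (λ u v → u + (0ℤ + x * v)) (evalₚ-scale a q x) (evalₚ-* p q x) ⟩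
  a * evalₚ q x + (0ℤ + x * (evalₚ p x * evalₚ q x))
    ≡⟨ factor a x (evalₚ p x) (evalₚ q x) ⟩
  (a + x * evalₚ p x) * evalₚ q x ∎
  where
  open ≡-Reasoning
  factor : ∀ a x u v → a * v + (0ℤ + x * (u * v)) ≡ (a + x * u) * v
  factor = solve-∀

evalₚ-sumFin : ∀ {n} (f : Fin n → Poly) x → evalₚ (sumFin f) x ≡ sum (λ j → evalₚ (f j) x)
evalₚ-sumFin {zero}  f x = refl
evalₚ-sumFin {suc n} f x =
  trans (evalₚ-+ (f zero) (sumFin (f ∘ suc)) x) (cong (_+_ (evalₚ (f zero) x)) (evalₚ-sumFin (f ∘ suc) x))

evalₚ-det : ∀ n (M : Matrix Poly n) x → evalₚ (det n M) x ≡ detℤ n (λ i j → evalₚ (M i j) x)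
evalₚ-det zero    M x = cong (_+_ 1ℤ) (ℤP.*-zeroʳ x)
evalₚ-det (suc n) M x =
  trans (evalₚ-sumFin (λ j → scaleₚ (sign (toℕ j)) (M zero j *ₚ det n (minor M j))) x)
        (sum-cong-≗ term)
  where
  term : ∀ j → evalₚ (scaleₚ (sign (toℕ j)) (M zero j *ₚ det n (minor M j))) x
             ≡ laplaceTerm (λ i j → evalₚ (M i j) x) j
  term j = begin
    evalₚ (scaleₚ (sign (toℕ j)) (M zero j *ₚ det n (minor M j))) x
      ≡⟨ evalₚ-scale (sign (toℕ j)) (M zero j *ₚ det n (minor M j)) x ⟩
    sign (toℕ j) * evalₚ (M zero j *ₚ det n (minor M j)) x
      ≡⟨ cong (sign (toℕ j) *_) (evalₚ-* (M zero j) (det n (minor M j)) x) ⟩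
    sign (toℕ j) * (evalₚ (M zero j) x * evalₚ (det n (minor M j)) x)
      ≡⟨ cong (λ d → sign (toℕ j) * (evalₚ (M zero j) x * d)) (evalₚ-det n (minor M j) x) ⟩
    laplaceTerm (λ i j → evalₚ (M i j) x) j ∎
    where open ≡-Reasoning

evalₚ-vanishing : ∀ p x → [] ≈ₚ p → evalₚ p x ≡ 0ℤ
evalₚ-vanishing []      x _   = refl
evalₚ-vanishing (a ∷ p) x p≈0 =
  trans (cong₂ (λ a v → a + x * v) (sym (p≈0 0)) (evalₚ-vanishing p x (p≈0 ∘ suc)))
        (trans (ℤP.+-identityˡ (x * 0ℤ)) (ℤP.*-zeroʳ x))

evalₚ-resp-≈ₚ : ∀ p q x → p ≈ₚ q → evalₚ p x ≡ evalₚ q x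
evalₚ-resp-≈ₚ []      q       x p≈q = sym (evalₚ-vanishing q x p≈q)
evalₚ-resp-≈ₚ (a ∷ p) []      x p≈q = evalₚ-vanishing (a ∷ p) x (sym ∘ p≈q)
evalₚ-resp-≈ₚ (a ∷ p) (b ∷ q) x p≈q =
  cong₂ (λ c v → c + x * v) (p≈q 0) (evalₚ-resp-≈ₚ p q x (p≈q ∘ suc))

charMatrix : ∀ {n} → Matrix ℤ n → ℤ → Matrix ℤ n
charMatrix A x i j = (if does (i F.≟ j) then x else 0ℤ) - A i j

evalₚ-charPoly : ∀ n (A : Matrix ℤ n) x → evalₚ (charPoly n A) x ≡ detℤ n (charMatrix A x)
evalₚ-charPoly n A x =
  trans (evalₚ-det n _ x) (det-cong n (λ i j → entry (does (i F.≟ j)) (- A i j)))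
  where
  entry : ∀ b c → evalₚ ((if b then Xₚ else []) +ₚ constₚ c) x ≡ (if b then x else 0ℤ) + c
  entry true  c = trans (evalₚ-+ Xₚ (constₚ c) x) (simplify x c)
    where
    simplify : ∀ x c → (0ℤ + x * (1ℤ + x * 0ℤ)) + (c + x * 0ℤ) ≡ x + c
    simplify = solve-∀
  entry false c = trans (cong (_+_ c) (ℤP.*-zeroʳ x)) (ℤP.+-comm c 0ℤ)

multAtLeast-two-eval : ∀ n (A : Matrix ℤ n) λ₀ → MultAtLeast n A λ₀ 2 →
  Σ (ℤ → ℤ) λ Q → ∀ x → evalₚ (charPoly n A) x ≡ (x - λ₀) * ((x - λ₀) * Q x)
multAtLeast-two-eval n A λ₀ (q , χ≈) = evalₚ q , λ x → begin
  evalₚ (charPoly n A) x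
    ≡⟨ evalₚ-resp-≈ₚ (charPoly n A) ((linear ^ₚ 2) *ₚ q) x χ≈ ⟩
  evalₚ ((linear ^ₚ 2) *ₚ q) x
    ≡⟨ evalₚ-* (linear ^ₚ 2) q x ⟩
  evalₚ (linear *ₚ (linear *ₚ constₚ 1ℤ)) x * evalₚ q x
    ≡⟨ cong (_* evalₚ q x) (evalₚ-* linear (linear *ₚ constₚ 1ℤ) x) ⟩
  evalₚ linear x * evalₚ (linear *ₚ constₚ 1ℤ) x * evalₚ q x
    ≡⟨ cong (λ v → evalₚ linear x * v * evalₚ q x) (evalₚ-* linear (constₚ 1ℤ) x) ⟩
  evalₚ linear x * (evalₚ linear x * (1ℤ + x * 0ℤ)) * evalₚ q x
    ≡⟨ cong (λ l → l * (l * (1ℤ + x * 0ℤ)) * evalₚ q x) (evalₚ-linear x) ⟩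
  (x - λ₀) * ((x - λ₀) * (1ℤ + x * 0ℤ)) * evalₚ q x
    ≡⟨ simplify x (x - λ₀) (evalₚ q x) ⟩
  (x - λ₀) * ((x - λ₀) * evalₚ q x) ∎
  where
  open ≡-Reasoning
  linear : Poly
  linear = Xₚ +ₚ constₚ (- λ₀)
  evalₚ-linear : ∀ x → evalₚ linear x ≡ x - λ₀
  evalₚ-linear x = trans (evalₚ-+ Xₚ (constₚ (- λ₀)) x) (simplify′ x (- λ₀))
    where
    simplify′ : ∀ x c → (0ℤ + x * (1ℤ + x * 0ℤ)) + (c + x * 0ℤ) ≡ x + c
    simplify′ = solve-∀
  simplify : ∀ x l v → l * (l * (1ℤ + x * 0ℤ)) * v ≡ l * (l * v)
  simplify = solve-∀

-- Integer functions respecting differences, as polynomial functions do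

record RespectsDifferences (φ : ℤ → ℤ) : Set where
  constructor respectsDifferences
  field difference-∣ : ∀ x y → x - y ∣ φ x - φ y

const-respectsDifferences : ∀ c → RespectsDifferences (λ _ → c)
const-respectsDifferences c = respectsDifferences λ _ _ → divides 0ℤ (ℤP.+-inverseʳ c)

id-respectsDifferences : RespectsDifferences (λ x → x)
id-respectsDifferences = respectsDifferences λ _ _ → ∣-refl

+-respectsDifferences : ∀ {φ ψ} → RespectsDifferences φ → RespectsDifferences ψ →
                        RespectsDifferences (λ x → φ x + ψ x)
+-respectsDifferences {φ} {ψ} (respectsDifferences φ∣) (respectsDifferences ψ∣) = respectsDifferences λ x y →
  subst (x - y ∣_) (sym (regroup (φ x) (φ y) (ψ x) (ψ y))) (∣m∣n⇒∣m+n (φ∣ x y) (ψ∣ x y))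
  where
  regroup : ∀ a b c d → (a + c) - (b + d) ≡ (a - b) + (c - d)
  regroup = solve-∀

*-respectsDifferences : ∀ {φ ψ} → RespectsDifferences φ → RespectsDifferences ψ →
                        RespectsDifferences (λ x → φ x * ψ x)
*-respectsDifferences {φ} {ψ} (respectsDifferences φ∣) (respectsDifferences ψ∣) = respectsDifferences λ x y →
  subst (x - y ∣_) (sym (regroup (φ x) (φ y) (ψ x) (ψ y)))
        (∣m∣n⇒∣m+n (∣n⇒∣m*n (φ x) (ψ∣ x y)) (∣n⇒∣m*n (ψ y) (φ∣ x y)))
  where
  regroup : ∀ a b c d → a * c - b * d ≡ a * (c - d) + d * (a - b)
  regroup = solve-∀

sum-respectsDifferences : ∀ {n} (φ : Fin n → ℤ → ℤ) → (∀ j → RespectsDifferences (φ j)) →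
                          RespectsDifferences (λ x → sum (λ j → φ j x))
sum-respectsDifferences {zero}  φ φ-resp = const-respectsDifferences 0ℤ
sum-respectsDifferences {suc n} φ φ-resp =
  +-respectsDifferences (φ-resp zero) (sum-respectsDifferences (φ ∘ suc) (φ-resp ∘ suc))

det-respectsDifferences : ∀ n (M : ℤ → Matrix ℤ n) → (∀ i j → RespectsDifferences (λ x → M x i j)) →
                          RespectsDifferences (λ x → detℤ n (M x))
det-respectsDifferences zero    M M-resp = const-respectsDifferences 1ℤ
det-respectsDifferences (suc n) M M-resp = sum-respectsDifferences (λ j x → laplaceTerm (M x) j) λ j →
  *-respectsDifferences (const-respectsDifferences (sign (toℕ j)))
    (*-respectsDifferences (M-resp zero j)
      (det-respectsDifferences n (λ x → minorℤ (M x) j) (λ r c → M-resp (suc r) (punchIn j c))))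

charMatrix-respectsDifferences : ∀ {n} (A : Matrix ℤ n) i j → RespectsDifferences (λ x → charMatrix A x i j)
charMatrix-respectsDifferences A i j =
  +-respectsDifferences (diagonal (does (i F.≟ j))) (const-respectsDifferences (- A i j))
  where
  diagonal : ∀ b → RespectsDifferences (λ x → if b then x else 0ℤ)
  diagonal true  = id-respectsDifferences
  diagonal false = const-respectsDifferences 0ℤ

respectsDifferences-vanishesAt-minusOne : ∀ {φ} → RespectsDifferences φ →
  (∀ m → + suc m ∣ φ (+ m)) → φ -1ℤ ≡ 0ℤ
respectsDifferences-vanishesAt-minusOne {φ} (respectsDifferences φ∣) divisible =
  ℤP.∣i∣≡0⇒i≡0 (selfDivisor≡0 m (∣⇒∣ᵤ m+1∣φ-1))
  where
  -- m + 1 divides φ(−1) but exceeds |φ(−1)|.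
  m : ℕ
  m = ℤ.∣ φ -1ℤ ∣
  step : + m - -1ℤ ≡ + suc m
  step = trans (sym (ℤP.pos-+ m 1)) (cong +_ (ℕP.+-comm m 1))
  m+1∣φ-1 : + suc m ∣ φ -1ℤ
  m+1∣φ-1 = subst (+ suc m ∣_) (recover (φ (+ m)) (φ -1ℤ))
                  (∣m∣n⇒∣m-n (divisible m) (subst (_∣ φ (+ m) - φ -1ℤ) step (φ∣ (+ m) -1ℤ)))
    where
    recover : ∀ a b → a - (a - b) ≡ b
    recover = solve-∀
  selfDivisor≡0 : ∀ m → suc m ∣ℕ m → m ≡ 0
  selfDivisor≡0 zero    _  = refl
  selfDivisor≡0 (suc m) m+2∣m+1 = ⊥-elim (>⇒∤ (ℕP.n<1+n (suc m)) m+2∣m+1)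

-- The quotient matrix and its characteristic values

-- Depends on the indices only through these values, so that deleting the first two indices
-- of quotientMatrix′ gives quotientMatrix′ of the tail of α definitionally.
quotientEntry : (i<j j<i iOdd jOdd : Bool) (αᵢ αⱼ : ℕ) → ℤ
quotientEntry true  _     _    jOdd _  αⱼ = if jOdd then 0ℤ else + αⱼ
quotientEntry false true  iOdd _    _  αⱼ = if iOdd then 0ℤ else + αⱼ
quotientEntry false false iOdd _    αᵢ _  = if iOdd then + αᵢ - 1ℤ else 0ℤ

quotientMatrix′ : ∀ n → (Fin n → ℕ) → Matrix ℤ n
quotientMatrix′ n α i j =
  quotientEntry (toℕ i ℕ.<ᵇ toℕ j) (toℕ j ℕ.<ᵇ toℕ i) (oddIdx i) (oddIdx j) (α i) (α j)

quotientMatrix≡quotientMatrix′ : ∀ k α i j → quotientMatrix k α i j ≡ quotientMatrix′ (2 ℕ.* k) α i j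
quotientMatrix≡quotientMatrix′ k α i j with toℕ i ℕ.<ᵇ toℕ j | toℕ j ℕ.<ᵇ toℕ i
... | true  | _     = refl
... | false | true  = refl
... | false | false = refl

charValue : ∀ n → (Fin n → ℕ) → ℤ → ℤ
charValue n α x = detℤ n (charMatrix (quotientMatrix′ n α) x)

evenPart : ∀ {n} → (Fin n → ℕ) → Fin n → ℤ
evenPart α j = if oddIdx j then 0ℤ else + α j

evenIndicator : ∀ {n} → Fin n → ℤ
evenIndicator r = if oddIdx r then 0ℤ else 1ℤ

-- Deleting the first row and the first or second column of charMatrix for (α₁,α₂,α₃,…)
-- leaves such a matrix for the tail (α₃,…), with suitable corner c and border scale d.
bordered : ∀ n → (Fin n → ℕ) → ℤ → (c d : ℤ) → Matrix ℤ (suc n)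
bordered n α x c d zero    zero    = c
bordered n α x c d zero    (suc j) = - evenPart α j
bordered n α x c d (suc r) zero    = - (d * evenIndicator r)
bordered n α x c d (suc r) (suc j) = charMatrix (quotientMatrix′ n α) x r j

borderValue : ∀ n → (Fin n → ℕ) → ℤ → ℤ
borderValue n α x = detℤ (suc n) (bordered n α x 0ℤ 1ℤ)

det-bordered : ∀ n α x c d → detℤ (suc n) (bordered n α x c d) ≡ c * charValue n α x + d * borderValue n α x
det-bordered n α x c d = begin
  detℤ (suc n) (bordered n α x c d)
    ≡⟨ det-linear-firstColumn n {c} {d} {bordered n α x c d} {bordered n α x 1ℤ 0ℤ} {bordered n α x 0ℤ 1ℤ}
                              (firstColumnCombination firstColumn sameRest sameRest) ⟩
  c * detℤ (suc n) (bordered n α x 1ℤ 0ℤ) + d * borderValue n α x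
    ≡⟨ cong (λ v → c * v + d * borderValue n α x) (det-firstColumnZeroBelow n (bordered n α x 1ℤ 0ℤ) (λ _ → refl)) ⟩
  c * (1ℤ * charValue n α x) + d * borderValue n α x
    ≡⟨ cong (λ v → c * v + d * borderValue n α x) (ℤP.*-identityˡ (charValue n α x)) ⟩
  c * charValue n α x + d * borderValue n α x ∎
  where
  open ≡-Reasoning
  sameRest : ∀ {c d c′ d′} r j → bordered n α x c d r (suc j) ≡ bordered n α x c′ d′ r (suc j)
  sameRest zero    j = refl
  sameRest (suc r) j = refl
  firstColumn : ∀ r → bordered n α x c d r zero ≡ c * bordered n α x 1ℤ 0ℤ r zero + d * bordered n α x 0ℤ 1ℤ r zero
  firstColumn zero    = corner c d
    where
    corner : ∀ c d → c ≡ c * 1ℤ + d * 0ℤ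
    corner = solve-∀
  firstColumn (suc r) = border c d (evenIndicator r)
    where
    border : ∀ c d e → - (d * e) ≡ c * - (0ℤ * e) + d * - (1ℤ * e)
    border = solve-∀

bordered-respectsDifferences : ∀ n α c d i j → RespectsDifferences (λ x → bordered n α x c d i j)
bordered-respectsDifferences n α c d zero    zero    = const-respectsDifferences c
bordered-respectsDifferences n α c d zero    (suc j) = const-respectsDifferences (- evenPart α j)
bordered-respectsDifferences n α c d (suc r) zero    = const-respectsDifferences (- (d * evenIndicator r))
bordered-respectsDifferences n α c d (suc r) (suc j) = charMatrix-respectsDifferences (quotientMatrix′ n α) r j

charValue-respectsDifferences : ∀ n α → RespectsDifferences (charValue n α)
charValue-respectsDifferences n α =
  det-respectsDifferences n (charMatrix (quotientMatrix′ n α)) (charMatrix-respectsDifferences (quotientMatrix′ n α))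

borderValue-respectsDifferences : ∀ n α → RespectsDifferences (borderValue n α)
borderValue-respectsDifferences n α =
  det-respectsDifferences (suc n) (λ x → bordered n α x 0ℤ 1ℤ) (bordered-respectsDifferences n α 0ℤ 1ℤ)

negated-evenEntry : ∀ (odd : Bool) a → 0ℤ - (if odd then 0ℤ else + a) ≡ - (+ a * (if odd then 0ℤ else 1ℤ))
negated-evenEntry true  a = cong -_ (sym (ℤP.*-zeroʳ (+ a)))
negated-evenEntry false a = trans (ℤP.+-identityˡ (- + a)) (cong -_ (sym (ℤP.*-identityʳ (+ a))))

module Recurrence (n : ℕ) (α : Fin (suc (suc n)) → ℕ) (x : ℤ) where

  α′ : Fin n → ℕ
  α′ j = α (suc (suc j))

  A₀ A₁ χ′ E′ : ℤ
  A₀ = + α zero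
  A₁ = + α (suc zero)
  χ′ = charValue n α′ x
  E′ = borderValue n α′ x

  B : Matrix ℤ (suc (suc n))
  B = charMatrix (quotientMatrix′ (suc (suc n)) α) x

  D : Matrix ℤ (suc (suc (suc n)))
  D = bordered (suc (suc n)) α x 0ℤ 1ℤ

  minorB₀ : ∀ r c → minorℤ B zero r c ≡ bordered n α′ x x A₁ r c
  minorB₀ zero    zero    = ℤP.+-identityʳ x
  minorB₀ zero    (suc c) = ℤP.+-identityˡ (- evenPart α′ c)
  minorB₀ (suc r) zero    = negated-evenEntry (oddIdx r) (α (suc zero))
  minorB₀ (suc r) (suc c) = refl

  minorB₁ : ∀ r c → minorℤ B (suc zero) r c ≡ bordered n α′ x (- A₀) A₀ r c
  minorB₁ zero    zero    = ℤP.+-identityˡ (- A₀)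
  minorB₁ zero    (suc c) = ℤP.+-identityˡ (- evenPart α′ c)
  minorB₁ (suc r) zero    = negated-evenEntry (oddIdx r) (α zero)
  minorB₁ (suc r) (suc c) = refl

  minorD₁₁ : ∀ r c → minorℤ (minorℤ D (suc zero)) (suc zero) r c ≡ bordered n α′ x -1ℤ 1ℤ r c
  minorD₁₁ zero    zero    = refl
  minorD₁₁ zero    (suc c) = ℤP.+-identityˡ (- evenPart α′ c)
  minorD₁₁ (suc r) zero    = refl
  minorD₁₁ (suc r) (suc c) = refl

  det-minorB₀ : detℤ (suc n) (minorℤ B zero) ≡ x * χ′ + A₁ * E′
  det-minorB₀ = trans (det-cong (suc n) minorB₀) (det-bordered n α′ x x A₁)

  det-minorB₁ : detℤ (suc n) (minorℤ B (suc zero)) ≡ - A₀ * χ′ + A₀ * E′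
  det-minorB₁ = trans (det-cong (suc n) minorB₁) (det-bordered n α′ x (- A₀) A₀)

  det-minorD₁₁ : detℤ (suc n) (minorℤ (minorℤ D (suc zero)) (suc zero)) ≡ -1ℤ * χ′ + 1ℤ * E′
  det-minorD₁₁ = trans (det-cong (suc n) minorD₁₁) (det-bordered n α′ x -1ℤ 1ℤ)

  charValue-step : charValue (suc (suc n)) α x ≡ (x + 1ℤ) * (x * χ′ + A₁ * E′) + (x + A₁) * A₀ * (E′ - χ′)
  charValue-step = begin
    detℤ (suc (suc n)) B
      ≡⟨ det-expandAlongRowDifference n B (λ _ → refl) ⟩
    (B zero zero - B (suc zero) zero) * detℤ (suc n) (minorℤ B zero)
      - (B zero (suc zero) - B (suc zero) (suc zero)) * detℤ (suc n) (minorℤ B (suc zero))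
      ≡⟨ cong₂ (λ u v → (B zero zero - B (suc zero) zero) * u - (B zero (suc zero) - B (suc zero) (suc zero)) * v)
               det-minorB₀ det-minorB₁ ⟩
    ((x - (A₀ - 1ℤ)) - (0ℤ - A₀)) * (x * χ′ + A₁ * E′) - ((0ℤ - A₁) - (x - 0ℤ)) * (- A₀ * χ′ + A₀ * E′)
      ≡⟨ collect x A₀ A₁ χ′ E′ ⟩
    (x + 1ℤ) * (x * χ′ + A₁ * E′) + (x + A₁) * A₀ * (E′ - χ′) ∎
    where
    open ≡-Reasoning
    collect : ∀ x a₀ a₁ f e →
      ((x - (a₀ - 1ℤ)) - (0ℤ - a₀)) * (x * f + a₁ * e) - ((0ℤ - a₁) - (x - 0ℤ)) * (- a₀ * f + a₀ * e)
      ≡ (x + 1ℤ) * (x * f + a₁ * e) + (x + a₁) * a₀ * (e - f)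
    collect = solve-∀

  det-minorD₁ : detℤ (suc (suc n)) (minorℤ D (suc zero))
              ≡ 1ℤ * (x * χ′ + A₁ * E′) - ((0ℤ - A₁) - x) * (-1ℤ * χ′ + 1ℤ * E′)
  det-minorD₁ = begin
    detℤ (suc (suc n)) (minorℤ D (suc zero))
      ≡⟨ det-expandAlongRowDifference n (minorℤ D (suc zero)) (λ _ → refl) ⟩
    (- (1ℤ * 0ℤ) - - (1ℤ * 1ℤ)) * detℤ (suc n) (minorℤ B zero)
      - ((0ℤ - A₁) - (x - 0ℤ)) * detℤ (suc n) (minorℤ (minorℤ D (suc zero)) (suc zero))
      ≡⟨ cong₂ (λ u v → 1ℤ * u - ((0ℤ - A₁) - (x - 0ℤ)) * v) det-minorB₀ det-minorD₁₁ ⟩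
    1ℤ * (x * χ′ + A₁ * E′) - ((0ℤ - A₁) - (x - 0ℤ)) * (-1ℤ * χ′ + 1ℤ * E′)
      ≡⟨ cong (λ v → 1ℤ * (x * χ′ + A₁ * E′) - ((0ℤ - A₁) - v) * (-1ℤ * χ′ + 1ℤ * E′)) (ℤP.+-identityʳ x) ⟩
    1ℤ * (x * χ′ + A₁ * E′) - ((0ℤ - A₁) - x) * (-1ℤ * χ′ + 1ℤ * E′) ∎
    where open ≡-Reasoning

  borderValue-step : borderValue (suc (suc n)) α x ≡ (x - A₀ + 1ℤ) * (- A₁ * χ′ + (x + A₁ + A₁) * E′)
  borderValue-step = begin
    detℤ (suc (suc (suc n))) D
      ≡⟨ det-expandAlongRowDifference (suc n) D sameBeyondTwo ⟩
    (0ℤ - - (1ℤ * 0ℤ)) * detℤ (suc (suc n)) B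
      - (- 0ℤ - (x - (A₀ - 1ℤ))) * detℤ (suc (suc n)) (minorℤ D (suc zero))
      ≡⟨ cong (λ v → (0ℤ - - (1ℤ * 0ℤ)) * detℤ (suc (suc n)) B - (- 0ℤ - (x - (A₀ - 1ℤ))) * v) det-minorD₁ ⟩
    (0ℤ - - (1ℤ * 0ℤ)) * detℤ (suc (suc n)) B
      - (- 0ℤ - (x - (A₀ - 1ℤ))) * (1ℤ * (x * χ′ + A₁ * E′) - ((0ℤ - A₁) - x) * (-1ℤ * χ′ + 1ℤ * E′))
      ≡⟨ collect x A₀ A₁ χ′ E′ (detℤ (suc (suc n)) B) ⟩
    (x - A₀ + 1ℤ) * (- A₁ * χ′ + (x + A₁ + A₁) * E′) ∎
    where
    open ≡-Reasoning
    sameBeyondTwo : ∀ j → D zero (suc (suc j)) ≡ D (suc zero) (suc (suc j))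
    sameBeyondTwo zero    = sym (ℤP.+-identityˡ (- A₁))
    sameBeyondTwo (suc j) = sym (ℤP.+-identityˡ (- evenPart α′ j))
    collect : ∀ x a₀ a₁ f e b →
      (0ℤ - - (1ℤ * 0ℤ)) * b - (- 0ℤ - (x - (a₀ - 1ℤ))) * (1ℤ * (x * f + a₁ * e) - ((0ℤ - a₁) - x) * (-1ℤ * f + 1ℤ * e))
      ≡ (x - a₀ + 1ℤ) * (- a₁ * f + (x + a₁ + a₁) * e)
    collect = solve-∀

-- The sign invariant at −1

-- e and f have weakly opposite signs and are not both zero.
record OppositeSigns (e f : ℤ) : Set where
  constructor oppositeSigns
  field
    scale   : ℤ
    a b     : ℕ
    scale≢0 : scale ≢ 0ℤ
    a+b>0   : 0 ℕ.< a ℕ.+ b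
    e≡      : e ≡ scale * + a
    f≡      : f ≡ - (scale * + b)

oppositeSigns⇒difference≢0 : ∀ {e f} → OppositeSigns e f → e - f ≢ 0ℤ
oppositeSigns⇒difference≢0 (oppositeSigns s a b s≢0 a+b>0 refl refl) e-f≡0 =
  [ s≢0 , (λ a+b≡0 → ℕP.<⇒≢ a+b>0 (sym (ℤP.+-injective a+b≡0))) ]′
    (ℤP.i*j≡0⇒i≡0∨j≡0 s (trans (factor s a b) e-f≡0))
  where
  factor : ∀ s a b → s * + (a ℕ.+ b) ≡ s * + a - - (s * + b)
  factor s a b = trans (cong (s *_) (ℤP.pos-+ a b)) (distrib s (+ a) (+ b))
    where
    distrib : ∀ s a b → s * (a + b) ≡ s * a - - (s * b)
    distrib = solve-∀

-- The recurrences of Recurrence at x = −1.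
oppositeSigns-step : ∀ a₀ a₁ {e f} → 0 ℕ.< a₀ → 0 ℕ.< a₁ → OppositeSigns e f →
  OppositeSigns ((-1ℤ - + a₀ + 1ℤ) * (- + a₁ * f + (-1ℤ + + a₁ + + a₁) * e))
                ((-1ℤ + 1ℤ) * (-1ℤ * f + + a₁ * e) + (-1ℤ + + a₁) * + a₀ * (e - f))
oppositeSigns-step (suc p₀) (suc p₁) _ _ (oppositeSigns s a b s≢0 a+b>0 refl refl) =
  oppositeSigns (- s) a′ b′ (s≢0 ∘ negated≡0) (ℕP.<-≤-trans a+b>0 a+b≤a′+b′)
    (trans (newE (+ p₀) (+ p₁) s (+ a) (+ b)) (cong (- s *_) (sym a′≡)))
    (trans (newF (+ p₀) (+ p₁) s (+ a) (+ b)) (cong (λ v → - (- s * v)) (sym b′≡)))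
  where
  a′ b′ : ℕ
  a′ = suc p₀ ℕ.* (suc p₁ ℕ.* b ℕ.+ (suc p₁ ℕ.+ p₁) ℕ.* a)
  b′ = p₁ ℕ.* suc p₀ ℕ.* (a ℕ.+ b)
  a′≡ : + a′ ≡ (1ℤ + + p₀) * ((1ℤ + + p₁) * + b + ((1ℤ + + p₁) + + p₁) * + a)
  a′≡ = trans (ℤP.pos-* (suc p₀) _) (cong (+ suc p₀ *_)
          (trans (ℤP.pos-+ (suc p₁ ℕ.* b) _)
                 (cong₂ _+_ (ℤP.pos-* (suc p₁) b)
                            (trans (ℤP.pos-* (suc p₁ ℕ.+ p₁) a) (cong (_* + a) (ℤP.pos-+ (suc p₁) p₁))))))
  b′≡ : + b′ ≡ + p₁ * (1ℤ + + p₀) * (+ a + + b)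
  b′≡ = trans (ℤP.pos-* (p₁ ℕ.* suc p₀) _) (cong₂ _*_ (ℤP.pos-* p₁ (suc p₀)) (ℤP.pos-+ a b))
  a+b≤a′+b′ : a ℕ.+ b ℕ.≤ a′ ℕ.+ b′
  a+b≤a′+b′ = begin
    a ℕ.+ b                                       ≡⟨ ℕP.+-comm a b ⟩
    b ℕ.+ a                                       ≤⟨ ℕP.+-mono-≤ (ℕP.m≤n*m b (suc p₁)) (ℕP.m≤n*m a (suc p₁ ℕ.+ p₁)) ⟩
    suc p₁ ℕ.* b ℕ.+ (suc p₁ ℕ.+ p₁) ℕ.* a       ≤⟨ ℕP.m≤n*m _ (suc p₀) ⟩
    a′                                            ≤⟨ ℕP.m≤m+n a′ b′ ⟩
    a′ ℕ.+ b′                                     ∎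
    where open ℕP.≤-Reasoning
  negated≡0 : - s ≡ 0ℤ → s ≡ 0ℤ
  negated≡0 -s≡0 = trans (sym (ℤP.neg-involutive s)) (cong -_ -s≡0)
  newE : ∀ P₀ P₁ s A B →
    (-1ℤ - (1ℤ + P₀) + 1ℤ) * (- (1ℤ + P₁) * - (s * B) + (-1ℤ + (1ℤ + P₁) + (1ℤ + P₁)) * (s * A))
    ≡ - s * ((1ℤ + P₀) * ((1ℤ + P₁) * B + ((1ℤ + P₁) + P₁) * A))
  newE = solve-∀
  newF : ∀ P₀ P₁ s A B →
    (-1ℤ + 1ℤ) * (-1ℤ * - (s * B) + (1ℤ + P₁) * (s * A)) + (-1ℤ + (1ℤ + P₁)) * (1ℤ + P₀) * (s * A - - (s * B))
    ≡ - (- s * (P₁ * (1ℤ + P₀) * (A + B)))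
  newF = solve-∀

oppositeSigns-atMinusOne : ∀ n (α : Fin n → ℕ) → (∀ i → 0 ℕ.< α i) → evenℕ n ≡ true →
  OppositeSigns (borderValue n α -1ℤ) (charValue n α -1ℤ)
oppositeSigns-atMinusOne zero          α α>0 _    = oppositeSigns -1ℤ 0 1 (λ ()) ℕ.z<s refl refl
oppositeSigns-atMinusOne (suc (suc n)) α α>0 even =
  subst₂ OppositeSigns (sym borderValue-step) (sym charValue-step)
    (oppositeSigns-step (α zero) (α (suc zero)) (α>0 zero) (α>0 (suc zero))
      (oppositeSigns-atMinusOne n α′ (λ i → α>0 (suc (suc i))) even))
  where open Recurrence n α -1ℤ

module AtMinusOne (n : ℕ) (α : Fin (suc (suc n)) → ℕ) (α>0 : ∀ i → 0 ℕ.< α i) (even : evenℕ n ≡ true) where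
  open Recurrence n α -1ℤ

  difference≢0 : E′ - χ′ ≢ 0ℤ
  difference≢0 = oppositeSigns⇒difference≢0 (oppositeSigns-atMinusOne n α′ (λ i → α>0 (suc (suc i))) even)

  charValue-atMinusOne : charValue (suc (suc n)) α -1ℤ ≡ (-1ℤ + A₁) * A₀ * (E′ - χ′)
  charValue-atMinusOne = trans charValue-step (ℤP.+-identityˡ ((-1ℤ + A₁) * A₀ * (E′ - χ′)))

  minusOne-root⇔ : charValue (suc (suc n)) α -1ℤ ≡ 0ℤ ⇔ α (suc zero) ≡ 1
  minusOne-root⇔ = mk⇔ (root⇒ (α (suc zero)) (α>0 (suc zero)) ∘ trans (sym charValue-atMinusOne))
                       (λ α₁≡1 → trans charValue-atMinusOne (cong (λ a → (-1ℤ + + a) * A₀ * (E′ - χ′)) α₁≡1))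
    where
    root⇒ : ∀ a₁ → 0 ℕ.< a₁ → (-1ℤ + + a₁) * A₀ * (E′ - χ′) ≡ 0ℤ → a₁ ≡ 1
    root⇒ (suc zero) _ _ = refl
    root⇒ (suc (suc p)) _ product≡0 with ℤP.i*j≡0⇒i≡0∨j≡0 (+ suc p * A₀) product≡0
    ... | inj₂ difference≡0 = ⊥-elim (difference≢0 difference≡0)
    ... | inj₁ p+1*A₀≡0 with ℤP.i*j≡0⇒i≡0∨j≡0 (+ suc p) p+1*A₀≡0
    ...   | inj₁ ()
    ...   | inj₂ A₀≡0 = ⊥-elim (ℕP.<⇒≢ (α>0 zero) (sym (ℤP.+-injective A₀≡0)))

  reducedValue : ℤ → ℤ
  reducedValue x = (x - A₀) * charValue n α′ x + (1ℤ + A₀) * borderValue n α′ x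

  charValue-factor : α (suc zero) ≡ 1 → ∀ x → charValue (suc (suc n)) α x ≡ (x + 1ℤ) * reducedValue x
  charValue-factor α₁≡1 x = begin
    charValue (suc (suc n)) α x
      ≡⟨ Recurrence.charValue-step n α x ⟩
    (x + 1ℤ) * (x * f + + α (suc zero) * e) + (x + + α (suc zero)) * A₀ * (e - f)
      ≡⟨ cong (λ a → (x + 1ℤ) * (x * f + + a * e) + (x + + a) * A₀ * (e - f)) α₁≡1 ⟩
    (x + 1ℤ) * (x * f + 1ℤ * e) + (x + 1ℤ) * A₀ * (e - f)
      ≡⟨ collect x A₀ f e ⟩
    (x + 1ℤ) * reducedValue x ∎
    where
    open ≡-Reasoning
    f e : ℤ
    f = charValue n α′ x
    e = borderValue n α′ x
    collect : ∀ x a f e → (x + 1ℤ) * (x * f + 1ℤ * e) + (x + 1ℤ) * a * (e - f) ≡ (x + 1ℤ) * ((x - a) * f + (1ℤ + a) * e)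
    collect = solve-∀

  reducedValue≢0 : reducedValue -1ℤ ≢ 0ℤ
  reducedValue≢0 reduced≡0 =
    [ (λ ()) , difference≢0 ]′ (ℤP.i*j≡0⇒i≡0∨j≡0 (1ℤ + A₀) (trans (atMinusOne A₀ χ′ E′) reduced≡0))
    where
    atMinusOne : ∀ a f e → (1ℤ + a) * (e - f) ≡ (-1ℤ - a) * f + (1ℤ + a) * e
    atMinusOne = solve-∀

  reducedValue-respectsDifferences : RespectsDifferences reducedValue
  reducedValue-respectsDifferences =
    +-respectsDifferences
      (*-respectsDifferences (+-respectsDifferences id-respectsDifferences (const-respectsDifferences (- A₀)))
                             (charValue-respectsDifferences n α′))
      (*-respectsDifferences (const-respectsDifferences (1ℤ + A₀)) (borderValue-respectsDifferences n α′))

  minusOne-notDoubleRoot : α (suc zero) ≡ 1 → ∀ (Q : ℤ → ℤ) →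
    ¬ (∀ x → charValue (suc (suc n)) α x ≡ (x - -1ℤ) * ((x - -1ℤ) * Q x))
  minusOne-notDoubleRoot α₁≡1 Q doubleRoot =
    reducedValue≢0 (respectsDifferences-vanishesAt-minusOne reducedValue-respectsDifferences divisible)
    where
    divisible : ∀ m → + suc m ∣ reducedValue (+ m)
    divisible m = divides (Q (+ m)) (trans (ℤP.*-cancelˡ-≡ (+ suc m) _ _ cancellable) (ℤP.*-comm (+ suc m) (Q (+ m))))
      where
      m+1≡ : + m + 1ℤ ≡ + suc m
      m+1≡ = trans (sym (ℤP.pos-+ m 1)) (cong +_ (ℕP.+-comm m 1))
      cancellable : + suc m * reducedValue (+ m) ≡ + suc m * (+ suc m * Q (+ m))
      cancellable = subst (λ k → k * reducedValue (+ m) ≡ k * (k * Q (+ m))) m+1≡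
                          (trans (sym (charValue-factor α₁≡1 (+ m))) (doubleRoot (+ m)))

-- Phrased via an index at position 1, since 2 * k is not definitionally of the form suc (suc n).
minusOne-simpleEigenvalue : ∀ n (α : Fin n → ℕ) (i : Fin n) → toℕ i ≡ 1 → (∀ j → 0 ℕ.< α j) → evenℕ n ≡ true →
  (charValue n α -1ℤ ≡ 0ℤ ⇔ α i ≡ 1) ×
  (α i ≡ 1 → ∀ (Q : ℤ → ℤ) → ¬ (∀ x → charValue n α x ≡ (x - -1ℤ) * ((x - -1ℤ) * Q x)))
minusOne-simpleEigenvalue (suc (suc n)) α (suc zero) refl α>0 even = minusOne-root⇔ , minusOne-notDoubleRoot
  where open AtMinusOne n α α>0 even
minusOne-simpleEigenvalue (suc n)       α zero          ()
minusOne-simpleEigenvalue (suc zero)    α (suc ())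
minusOne-simpleEigenvalue (suc (suc n)) α (suc (suc i)) ()

evenℕ-double : ∀ k → evenℕ (2 ℕ.* k) ≡ true
evenℕ-double zero    = refl
evenℕ-double (suc k) rewrite ℕP.*-suc 2 k = evenℕ-double k

evalₚ-charPoly-quotientMatrix : ∀ k α x → evalₚ (charPoly (2 ℕ.* k) (quotientMatrix k α)) x ≡ charValue (2 ℕ.* k) α x
evalₚ-charPoly-quotientMatrix k α x =
  trans (evalₚ-charPoly (2 ℕ.* k) (quotientMatrix k α) x)
        (det-cong (2 ℕ.* k) λ i j → cong (λ q → (if does (i F.≟ j) then x else 0ℤ) - q)
                                         (quotientMatrix≡quotientMatrix′ k α i j))

mainTheorem4 : (k : ℕ) (hk : 1 ≤ k) (α : Fin (2 Data.Nat.* k) → ℕ) →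
               (∀ i → 1 ≤ α i) →
               (IsEigenvalue (2 Data.Nat.* k) (quotientMatrix k α) (- 1ℤ) ⇔ (α (idx2 k hk) ≡ 1))
               × (α (idx2 k hk) ≡ 1 → IsSimpleEigenvalue (2 Data.Nat.* k) (quotientMatrix k α) (- 1ℤ))
mainTheorem4 k hk α α≥1
  with minusOne-simpleEigenvalue (2 ℕ.* k) α (idx2 k hk) (FP.toℕ-fromℕ< _) α≥1 (evenℕ-double k)
... | root⇔ , notDoubleRoot = eigenvalue⇔ , simple
  where
  χ≡ : ∀ x → evalₚ (charPoly (2 ℕ.* k) (quotientMatrix k α)) x ≡ charValue (2 ℕ.* k) α x
  χ≡ = evalₚ-charPoly-quotientMatrix k α
  eigenvalue⇔ : IsEigenvalue (2 ℕ.* k) (quotientMatrix k α) (- 1ℤ) ⇔ (α (idx2 k hk) ≡ 1)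
  eigenvalue⇔ = mk⇔ (Equivalence.to root⇔ ∘ trans (sym (χ≡ -1ℤ))) (trans (χ≡ -1ℤ) ∘ Equivalence.from root⇔)
  simple : α (idx2 k hk) ≡ 1 → IsSimpleEigenvalue (2 ℕ.* k) (quotientMatrix k α) (- 1ℤ)
  simple α₂≡1 = Equivalence.from eigenvalue⇔ α₂≡1 , λ double →
    let (Q , χ≡double) = multAtLeast-two-eval (2 ℕ.* k) (quotientMatrix k α) (- 1ℤ) double
    in notDoubleRoot α₂≡1 Q (λ x → trans (sym (χ≡ x)) (χ≡double x))
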